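{- Let $H$ be a bounded implicative semilattice. For every $a\in H$ the set $\gamma_a=\{b\in H:\neg b\le b\text{ and }a\le b\}$ is a filter of $H$. Moreover, if $H$ is finite, then $\gamma_a$ has a minimum for every $a\in H$, i.e., $H$ has a $\gamma$-operator.
   Context: A bounded implicative semilattice is $(H,\wedge,\to,0,1)$ where $(H,\wedge)$ is a meet-semilattice with top $1$ and bottom $0$ and $a\wedge b\le c$ iff $a\le b\to c$; $\neg a:=a\to0$. A filter is an upset containing $1$ and closed under $\wedge$. A $\gamma$-operator on a bounded Hilbert algebra (here, the $\{\to,0,1\}$-reduct of $H$) is a map $\tau$ satisfying for all $a,b$: $\tau(a\to b)\le\tau(a)\to\tau(b)$, $a\le\tau(a)$, $\tau(a)\le((b\to a)\to b)\to b$, $\neg\tau(a)\le\tau(a)$, and $\tau(a)\le(a\to b)\to((\neg b\to b)\to b)$. -}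

module Defs where

open import Data.Nat using (ℕ)
open import Data.Fin using (Fin)
open import Data.Product using (Σ; _×_; ∃)
open import Function.Bundles using (_↔_)
open import Relation.Binary.PropositionalEquality using (_≡_)

record BIS : Set₁ where
  infixr 6 _∧_
  infixr 5 _⇒_
  infix 4 _≤_
  field
    Carrier : Set
    _∧_ : Carrier → Carrier → Carrier
    _⇒_ : Carrier → Carrier → Carrier
    𝟘 : Carrier
    𝟙 : Carrier

  _≤_ : Carrier → Carrier → Set
  a ≤ b = a ∧ b ≡ a

  field
    ∧-idem  : ∀ a → a ∧ a ≡ a
    ∧-comm  : ∀ a b → a ∧ b ≡ b ∧ a
    ∧-assoc : ∀ a b c → (a ∧ b) ∧ c ≡ a ∧ (b ∧ c)
    top     : ∀ a → a ≤ 𝟙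
    bottom  : ∀ a → 𝟘 ≤ a
    residuation₁ : ∀ a b c → a ∧ b ≤ c → a ≤ b ⇒ c
    residuation₂ : ∀ a b c → a ≤ b ⇒ c → a ∧ b ≤ c

  ¬_ : Carrier → Carrier
  ¬ a = a ⇒ 𝟘

  IsFilter : (Carrier → Set) → Set
  IsFilter F = (∀ a b → F a → a ≤ b → F b)
             × F 𝟙
             × (∀ a b → F a → F b → F (a ∧ b))

  γ : Carrier → Carrier → Set
  γ a b = (¬ b ≤ b) × (a ≤ b)

  IsMinimum : (Carrier → Set) → Carrier → Set
  IsMinimum S m = S m × (∀ b → S b → m ≤ b)

  IsγOperator : (Carrier → Carrier) → Set
  IsγOperator τ =
      (∀ a b → τ (a ⇒ b) ≤ τ a ⇒ τ b)
    × (∀ a → a ≤ τ a)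
    × (∀ a b → τ a ≤ ((b ⇒ a) ⇒ b) ⇒ b)
    × (∀ a → ¬ τ a ≤ τ a)
    × (∀ a b → τ a ≤ (a ⇒ b) ⇒ ((¬ b ⇒ b) ⇒ b))

IsFinite : BIS → Set
IsFinite H = ∃ λ (n : ℕ) → Fin n ↔ BIS.Carrier H

module Submission where

-- Call b *dense* when ¬ b ≤ b; then γ a is the set of dense
-- elements above a.  Dense elements form a filter: they are upward closed
-- (¬ is antitone), 𝟙 is dense, and if b, c are dense then ¬ b ≤ 𝟘 and
-- ¬ c ≤ 𝟘, from which ¬ (b ∧ c) ≤ 𝟘 follows by residuation.  Intersecting
-- with the principal filter ↑a gives the filter γ a.
--
-- In a finite algebra every decidable subset containing 𝟙 and closed under ∧
-- has a minimum, namely the meet of all its elements; equality is decidable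
-- via the bijection with Fin n, so γ a has a minimum τ a.  Finally, any map τ
-- sending a to the minimum of γ a is a γ-operator: each inequality τ a ≤ c
-- of the definition is obtained by checking that c belongs to γ a.

open import Defs
open import Data.Product using (Σ; _×_; _,_; proj₁; proj₂)
open import Data.Nat using (zero; suc)
open import Data.Fin using (Fin; zero; suc)
open import Data.Fin.Properties using () renaming (_≟_ to _≟ᶠ_)
open import Function.Bundles using (Inverse)
open import Function.Properties.Inverse using (↔⇒↣; ↔-sym)
open import Relation.Nullary using (Dec; yes; no)
open import Relation.Nullary.Decidable using (_×-dec_; via-injection)
open import Relation.Binary.PropositionalEquality
  using (_≡_; refl; sym; trans; cong; subst; module ≡-Reasoning)
open import Data.Empty using (⊥-elim)

module Properties (H : BIS) where
  open BIS H

  ≤-refl : ∀ a → a ≤ a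
  ≤-refl = ∧-idem

  ≤-trans : ∀ {a b c} → a ≤ b → b ≤ c → a ≤ c
  ≤-trans {a} {b} {c} a≤b b≤c = begin
      a ∧ c        ≡⟨ cong (_∧ c) (sym a≤b) ⟩
      (a ∧ b) ∧ c  ≡⟨ ∧-assoc a b c ⟩
      a ∧ (b ∧ c)  ≡⟨ cong (a ∧_) b≤c ⟩
      a ∧ b        ≡⟨ a≤b ⟩
      a            ∎
    where open ≡-Reasoning

  x∧y≤x : ∀ a b → a ∧ b ≤ a
  x∧y≤x a b = begin
      (a ∧ b) ∧ a  ≡⟨ ∧-assoc a b a ⟩
      a ∧ (b ∧ a)  ≡⟨ cong (a ∧_) (∧-comm b a) ⟩
      a ∧ (a ∧ b)  ≡⟨ sym (∧-assoc a a b) ⟩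
      (a ∧ a) ∧ b  ≡⟨ cong (_∧ b) (∧-idem a) ⟩
      a ∧ b        ∎
    where open ≡-Reasoning

  x∧y≤y : ∀ a b → a ∧ b ≤ b
  x∧y≤y a b = trans (∧-assoc a b b) (cong (a ∧_) (∧-idem b))

  ∧-greatest : ∀ {x a b} → x ≤ a → x ≤ b → x ≤ a ∧ b
  ∧-greatest {x} {a} {b} x≤a x≤b =
    trans (sym (∧-assoc x a b)) (trans (cong (_∧ b) x≤a) x≤b)

  ∧-monoˡ : ∀ {x y} z → x ≤ y → x ∧ z ≤ y ∧ z
  ∧-monoˡ {x} z x≤y = ∧-greatest (≤-trans (x∧y≤x x z) x≤y) (x∧y≤y x z)

  modus-ponens : ∀ a b → a ∧ (a ⇒ b) ≤ b
  modus-ponens a b =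
    subst (_≤ b) (∧-comm (a ⇒ b) a) (residuation₂ (a ⇒ b) a b (≤-refl _))

  weakening : ∀ b a → b ≤ a ⇒ b
  weakening b a = residuation₁ b a b (x∧y≤x b a)

  ex-falso : ∀ a b → ¬ a ≤ a ⇒ b
  ex-falso a b = residuation₁ (¬ a) a b
    (≤-trans (residuation₂ (¬ a) a 𝟘 (≤-refl _)) (bottom b))

  ¬-antitone : ∀ {b c} → b ≤ c → ¬ c ≤ ¬ b
  ¬-antitone {b} {c} b≤c = residuation₁ (¬ c) b 𝟘
    (≤-trans (subst (_≤ c ∧ ¬ c) (∧-comm b (¬ c)) (∧-monoˡ (¬ c) b≤c))
             (modus-ponens c 𝟘))

  Dense : Carrier → Set
  Dense b = ¬ b ≤ b

  dense⇒¬≤𝟘 : ∀ {b} → Dense b → ¬ b ≤ 𝟘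
  dense⇒¬≤𝟘 {b} d = ≤-trans (∧-greatest d (≤-refl (¬ b))) (modus-ponens b 𝟘)

  dense-between : ∀ {b c} → b ≤ c → ¬ b ≤ c → Dense c
  dense-between b≤c ¬b≤c = ≤-trans (¬-antitone b≤c) ¬b≤c

  dense-upward : ∀ {b c} → Dense b → b ≤ c → Dense c
  dense-upward d b≤c = dense-between b≤c (≤-trans d b≤c)

  -- From ¬(b ∧ c) ∧ b ∧ c ≤ 𝟘 we get ¬(b ∧ c) ∧ b ≤ ¬ c ≤ 𝟘, hence
  -- ¬(b ∧ c) ≤ ¬ b ≤ 𝟘 ≤ b ∧ c.
  dense-meet : ∀ {b c} → Dense b → Dense c → Dense (b ∧ c)
  dense-meet {b} {c} db dc = ≤-trans ¬bc≤¬b (≤-trans (dense⇒¬≤𝟘 db) (bottom (b ∧ c)))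
    where
    ¬bc = ¬ (b ∧ c)
    ¬bc∧b≤¬c : ¬bc ∧ b ≤ ¬ c
    ¬bc∧b≤¬c = residuation₁ (¬bc ∧ b) c 𝟘
      (subst (_≤ 𝟘) (sym (∧-assoc ¬bc b c)) (residuation₂ ¬bc (b ∧ c) 𝟘 (≤-refl _)))
    ¬bc≤¬b : ¬bc ≤ ¬ b
    ¬bc≤¬b = residuation₁ ¬bc b 𝟘 (≤-trans ¬bc∧b≤¬c (dense⇒¬≤𝟘 dc))

  γ-isFilter : ∀ a → IsFilter (γ a)
  γ-isFilter a =
      (λ b c (db , a≤b) b≤c → dense-upward db b≤c , ≤-trans a≤b b≤c)
    , (top (¬ 𝟙) , top a)
    , λ b c (db , a≤b) (dc , a≤c) → dense-meet db dc , ∧-greatest a≤b a≤c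

  ⋀ : ∀ k → (Fin k → Carrier) → Carrier
  ⋀ zero    f = 𝟙
  ⋀ (suc k) f = f zero ∧ ⋀ k (λ i → f (suc i))

  ⋀-lower : ∀ k f (i : Fin k) → ⋀ k f ≤ f i
  ⋀-lower (suc k) f zero    = x∧y≤x _ _
  ⋀-lower (suc k) f (suc i) = ≤-trans (x∧y≤y _ _) (⋀-lower k (λ j → f (suc j)) i)

  ⋀-closed : ∀ (S : Carrier → Set) → S 𝟙 → (∀ b c → S b → S c → S (b ∧ c)) →
             ∀ k f → (∀ i → S (f i)) → S (⋀ k f)
  ⋀-closed S S𝟙 S∧ zero    f Sf = S𝟙
  ⋀-closed S S𝟙 S∧ (suc k) f Sf =
    S∧ _ _ (Sf zero) (⋀-closed S S𝟙 S∧ k _ (λ i → Sf (suc i)))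

  -- A decidable subset containing 𝟙 and closed under ∧ of a finite algebra
  -- has a minimum: the meet of its members, where non-members are replaced
  -- by 𝟙.
  finite-minimum : IsFinite H → (S : Carrier → Set) → (∀ x → Dec (S x)) →
                   S 𝟙 → (∀ b c → S b → S c → S (b ∧ c)) → Σ Carrier (IsMinimum S)
  finite-minimum (n , enum) S S? S𝟙 S∧ =
      ⋀ n (λ i → keep (to i))
    , ⋀-closed S S𝟙 S∧ n _ (λ i → keep∈S (to i))
    , λ b Sb → subst (⋀ n (λ i → keep (to i)) ≤_)
                     (trans (cong keep (strictlyInverseˡ b)) (keep-id b Sb))
                     (⋀-lower n _ (from b))
    where
    open Inverse enum
    keep : Carrier → Carrier
    keep x with S? x
    ... | yes _ = x
    ... | no  _ = 𝟙
    keep∈S : ∀ x → S (keep x)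
    keep∈S x with S? x
    ... | yes Sx = Sx
    ... | no  _  = S𝟙
    keep-id : ∀ x → S x → keep x ≡ x
    keep-id x Sx with S? x
    ... | yes _   = refl
    ... | no ¬Sx  = ⊥-elim (¬Sx Sx)

  finite-γ? : IsFinite H → ∀ a b → Dec (γ a b)
  finite-γ? (n , enum) a b = (¬ b ∧ b ≟ ¬ b) ×-dec (a ∧ b ≟ a)
    where
    infix 4 _≟_
    _≟_ : (x y : Carrier) → Dec (x ≡ y)
    _≟_ = via-injection (↔⇒↣ (↔-sym enum)) _≟ᶠ_

  minima⇒γ-operator : (τ : Carrier → Carrier) →
                      (∀ a → IsMinimum (γ a) (τ a)) → IsγOperator τ
  minima⇒γ-operator τ τ-min =
      τ-⇒ , (λ a → proj₂ (τ∈γ a)) , τ-peirce , (λ a → proj₁ (τ∈γ a)) , τ-dense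
    where
    τ∈γ : ∀ a → γ a (τ a)
    τ∈γ a = proj₁ (τ-min a)
    τ≤ : ∀ a c → γ a c → τ a ≤ c
    τ≤ a = proj₂ (τ-min a)

    -- τ a ≤ (a ⇒ b) ⇒ τ b, hence τ (a ⇒ b) ≤ τ a ⇒ τ b.
    τ-⇒ : ∀ a b → τ (a ⇒ b) ≤ τ a ⇒ τ b
    τ-⇒ a b = τ≤ (a ⇒ b) (τ a ⇒ τ b)
        ( dense-upward τb-dense (weakening (τ b) (τ a))
        , residuation₁ (a ⇒ b) (τ a) (τ b)
            (subst (_≤ τ b) (∧-comm (τ a) (a ⇒ b))
                   (residuation₂ (τ a) (a ⇒ b) (τ b) τa≤a⇒b⇒τb)))
      where
      τb-dense = proj₁ (τ∈γ b)
      τa≤a⇒b⇒τb : τ a ≤ (a ⇒ b) ⇒ τ b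
      τa≤a⇒b⇒τb = τ≤ a ((a ⇒ b) ⇒ τ b)
        ( dense-upward τb-dense (weakening (τ b) (a ⇒ b))
        , residuation₁ a (a ⇒ b) (τ b) (≤-trans (modus-ponens a b) (proj₂ (τ∈γ b))))

    -- c = ((b ⇒ a) ⇒ b) ⇒ b lies above a, b and ¬ b.
    τ-peirce : ∀ a b → τ a ≤ ((b ⇒ a) ⇒ b) ⇒ b
    τ-peirce a b = τ≤ a (p ⇒ b)
        ( dense-between (weakening b p)
            (residuation₁ (¬ b) p b (≤-trans (∧-monoˡ p (ex-falso b a)) (modus-ponens (b ⇒ a) b)))
        , residuation₁ a p b (≤-trans (∧-monoˡ p (weakening a b)) (modus-ponens (b ⇒ a) b)))
      where p = (b ⇒ a) ⇒ b

    -- c = (a ⇒ b) ⇒ ((¬ b ⇒ b) ⇒ b) lies above a, b and ¬ b.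
    τ-dense : ∀ a b → τ a ≤ (a ⇒ b) ⇒ ((¬ b ⇒ b) ⇒ b)
    τ-dense a b = τ≤ a ((a ⇒ b) ⇒ (w ⇒ b))
        ( dense-between (≤-trans (weakening b w) (weakening (w ⇒ b) (a ⇒ b)))
            (residuation₁ (¬ b) (a ⇒ b) (w ⇒ b)
              (residuation₁ (¬ b ∧ (a ⇒ b)) w b
                (≤-trans (∧-monoˡ w (x∧y≤x (¬ b) (a ⇒ b))) (modus-ponens (¬ b) b))))
        , residuation₁ a (a ⇒ b) (w ⇒ b) (≤-trans (modus-ponens a b) (weakening b w)))
      where w = ¬ b ⇒ b

proposition4p3 : (H : BIS) → let open BIS H in
    (∀ a → IsFilter (γ a))
    × (IsFinite H →
        (∀ a → Σ Carrier (IsMinimum (γ a)))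
        × Σ (Carrier → Carrier) (λ τ → IsγOperator τ × (∀ a → IsMinimum (γ a) (τ a))))
proposition4p3 H = γ-isFilter , λ fin →
  let minimum : ∀ a → Σ Carrier (IsMinimum (γ a))
      minimum a = finite-minimum fin (γ a) (finite-γ? fin a)
                    (proj₁ (proj₂ (γ-isFilter a))) (proj₂ (proj₂ (γ-isFilter a)))
      τ : Carrier → Carrier
      τ a = proj₁ (minimum a)
  in minimum , τ , minima⇒γ-operator τ (λ a → proj₂ (minimum a)) , (λ a → proj₂ (minimum a))
  where open BIS H
        open Properties H
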